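{- Let $L,H$ be non-empty multisets of integers with compatible types $\mu_L,\mu_H$, and let $\mu_D$ be the type of $H-L$. Let $L',H'$ be non-empty multisets of integers of the same types as $L,H$ respectively. Then (i) if $H\succsim^{\mu_H}H'$ and $L'\succsim^{\mu_L}L$, then $H-L\succsim^{\mu_D}H'-L'$; (ii) if $H\succ^{\mu_H}H'$ and $L'\succsim^{\mu_L}L$, then $H-L\succ^{\mu_D}H'-L'$; (iii) if $H\succsim^{\mu_H}H'$ and $L'\succ^{\mu_L}L$, then $H-L\succ^{\mu_D}H'-L'$.
   Context: A multiset type is $\mu\in\{max,min,ms,dms\}$, with the following orders on finite multisets $S,T$ of integers: (max) $S\succsim^{max}T$ iff $\max(S)\ge\max(T)$ or $T$ is empty; $S\succ^{max}T$ iff $\max(S)>\max(T)$, or $T$ is empty while $S$ is not. (min) $S\succsim^{min}T$ iff $\min(S)\ge\min(T)$ or $S$ is empty; $S\succ^{min}T$ iff $\min(S)>\min(T)$, or $S$ is empty while $T$ is not. (ms) $S\succ^{ms}T$ iff $T$ is obtained from $S$ by replacing a non-empty sub-multiset $U\subseteq S$ by a (possibly empty) multiset $V$ with $U\succ^{max}V$; $S\succsim^{ms}T$ iff $S\succ^{ms}T$ or $S=T$. (dms) $S\succ^{dms}T$ iff $T$ is obtained from $S$ by replacing a sub-multiset $U\subseteq S$ by a non-empty multiset $V$ with $U\succ^{min}V$; $S\succsim^{dms}T$ iff $S\succ^{dms}T$ or $S=T$. Multiset difference: for non-empty multisets $L,H$ of types $\mu_L,\mu_H$: if $\mu_L\in\{max,min\}$,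 then $H-L=\{h-\mu_L(L) : h\in H\}$ (as a multiset, with $\mu_L(L)$ meaning $\min(L)$ or $\max(L)$), and it has type $\mu_H$; if $\mu_L\in\{ms,dms\}$ and $\mu_H\in\{min,max\}$, then $H-L=\{\mu_H(H)-\ell:\ell\in L\}$ and it has type $\overline{\mu_L}$, where $\overline{ms}=dms$, $\overline{dms}=ms$. In the remaining cases ($\mu_L,\mu_H$ both in $\{ms,dms\}$) the difference is undefined; $\mu_L,\mu_H$ are called compatible when $H-L$ is defined. -}

module Defs where

open import Data.Integer using (ℤ; _≤_; _<_; _⊔_; _⊓_; _-_)
open import Data.List using (List; []; _∷_; _++_; foldr; map)
open import Data.List.NonEmpty using (List⁺; _∷_; toList)
open import Data.List.Relation.Binary.Permutation.Propositional using (_↭_)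
open import Data.Product using (Σ; ∃; _×_; _,_)
open import Data.Sum using (_⊎_)
open import Data.Unit using (⊤)
open import Data.Empty using (⊥)

-- Finite multisets of integers are represented by lists, with multiset
-- equality given by permutation (_↭_). Non-empty multisets: List⁺ ℤ.

data MType : Set where
  max min ms dms : MType

max⁺ : ℤ → List ℤ → ℤ
max⁺ s ss = foldr _⊔_ s ss

min⁺ : ℤ → List ℤ → ℤ
min⁺ s ss = foldr _⊓_ s ss

NonEmpty : List ℤ → Set
NonEmpty []      = ⊥
NonEmpty (_ ∷ _) = ⊤

_≿max_ : List ℤ → List ℤ → Set
S ≿max [] = ⊤
[] ≿max (t ∷ ts) = ⊥
(s ∷ ss) ≿max (t ∷ ts) = max⁺ t ts ≤ max⁺ s ss

_≻max_ : List ℤ → List ℤ → Set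
[] ≻max T = ⊥
(s ∷ ss) ≻max [] = ⊤
(s ∷ ss) ≻max (t ∷ ts) = max⁺ t ts < max⁺ s ss

_≿min_ : List ℤ → List ℤ → Set
[] ≿min T = ⊤
(s ∷ ss) ≿min [] = ⊥
(s ∷ ss) ≿min (t ∷ ts) = min⁺ t ts ≤ min⁺ s ss

_≻min_ : List ℤ → List ℤ → Set
[] ≻min [] = ⊥
[] ≻min (t ∷ ts) = ⊤
(s ∷ ss) ≻min [] = ⊥
(s ∷ ss) ≻min (t ∷ ts) = min⁺ t ts < min⁺ s ss

-- (ms)  T = (S - U) + V with U non-empty, U ≻max V
_≻ms_ : List ℤ → List ℤ → Set
S ≻ms T = Σ (List ℤ) λ U → Σ (List ℤ) λ V → Σ (List ℤ) λ R →
  (S ↭ U ++ R) × (T ↭ V ++ R) × NonEmpty U × (U ≻max V)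

-- (dms) T = (S - U) + V with V non-empty, U ≻min V
_≻dms_ : List ℤ → List ℤ → Set
S ≻dms T = Σ (List ℤ) λ U → Σ (List ℤ) λ V → Σ (List ℤ) λ R →
  (S ↭ U ++ R) × (T ↭ V ++ R) × NonEmpty V × (U ≻min V)

Strict : MType → List ℤ → List ℤ → Set
Strict max S T = S ≻max T
Strict min S T = S ≻min T
Strict ms  S T = S ≻ms T
Strict dms S T = S ≻dms T

Weak : MType → List ℤ → List ℤ → Set
Weak max S T = S ≿max T
Weak min S T = S ≿min T
Weak ms  S T = S ≻ms T ⊎ (S ↭ T)
Weak dms S T = S ≻dms T ⊎ (S ↭ T)

-- value μ(L) for μ ∈ {max,min}
val⁺ : MType → List⁺ ℤ → ℤ
val⁺ max (s ∷ ss) = max⁺ s ss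
val⁺ min (s ∷ ss) = min⁺ s ss
val⁺ ms  (s ∷ ss) = s   -- never used
val⁺ dms (s ∷ ss) = s   -- never used

IsExtr : MType → Set
IsExtr max = ⊤
IsExtr min = ⊤
IsExtr ms  = ⊥
IsExtr dms = ⊥

-- compatibility: H - L is defined
Compatible : MType → MType → Set
Compatible μL μH = IsExtr μL ⊎ IsExtr μH

bar : MType → MType
bar ms  = dms
bar dms = ms
bar max = max  -- never used
bar min = min  -- never used

diffType : MType → MType → MType
diffType max μH = μH
diffType min μH = μH
diffType ms  μH = bar ms
diffType dms μH = bar dms

-- the multiset H - L (for incompatible types: meaningless value [])
diff : MType → MType → List⁺ ℤ → List⁺ ℤ → List ℤ
diff max μH H L = map (λ h → h - val⁺ max L) (toList H)
diff min μH H L = map (λ h → h - val⁺ min L) (toList H)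
diff ms  max H L = map (λ l → val⁺ max H - l) (toList L)
diff ms  min H L = map (λ l → val⁺ min H - l) (toList L)
diff dms max H L = map (λ l → val⁺ max H - l) (toList L)
diff dms min H L = map (λ l → val⁺ min H - l) (toList L)
diff ms  ms  H L = []
diff ms  dms H L = []
diff dms ms  H L = []
diff dms dms H L = []

-- Both kinds of difference are images of H or L under an order embedding
-- (x ↦ x − c) or an order reversal (x ↦ v − x), and these maps carry the
-- multiset orders of a type to those of the type of H − L.  Every order is
-- governed by a key value (the maximum for max and ms, the minimum for min and
-- dms): it never lets the key decrease, and a strictly larger key already gives
-- the strict order, by replacing the whole multiset.  So when the subtracted
-- extremum (μ_L(L) or μ_H(H)) changes strictly, the conclusion follows from the
-- keys alone; when it does not, H − L and H′ − L′ are images of H, H′ (or of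
-- L′, L) under one and the same map.
module Submission where

open import Defs
open import Data.Integer using (ℤ; _≤_; _<_; _≥_; _>_; _⊔_; _⊓_; _-_; -_)
open import Data.Integer.Properties
open import Data.List using (List; []; _∷_; _++_; map)
open import Data.List.Properties using (map-++; ++-identityʳ; foldr-preservesᵒ)
open import Data.List.NonEmpty as List⁺ using (List⁺; _∷_; toList)
open import Data.List.Membership.Propositional using (_∈_)
open import Data.List.Membership.Propositional.Properties using (∈-++⁺ˡ; ∈-++⁺ʳ; ∈-++⁻; foldr-selective)
open import Data.List.Relation.Unary.Any as Any using (here; there)
open import Data.List.Relation.Binary.Permutation.Propositional using (_↭_; ↭-sym; ↭-trans; ↭-reflexive)
open import Data.List.Relation.Binary.Permutation.Propositional.Properties using (∈-resp-↭; map⁺)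
open import Data.Product using (∃-syntax; _×_; _,_)
open import Data.Sum using (_⊎_; inj₁; inj₂)
open import Data.Unit using (tt)
open import Relation.Binary.Definitions using (Monotonic₁)
open import Relation.Binary.PropositionalEquality using (_≡_; refl; sym; trans; cong; subst₂)
open import Relation.Nullary using (yes; no)

≤⇒<⊎≡ : ∀ {i j : ℤ} → i ≤ j → i < j ⊎ i ≡ j
≤⇒<⊎≡ {i} {j} i≤j with i ≟ j
... | yes i≡j = inj₂ i≡j
... | no  i≢j = inj₁ (≤∧≢⇒< i≤j i≢j)

∈⇒≤max⁺ : ∀ {x} s ss → x ∈ s ∷ ss → x ≤ max⁺ s ss
∈⇒≤max⁺ s ss x∈ = foldr-preservesᵒ ≤-⊔ s ss (≤-head-or-tail x∈)
  where
  ≤-⊔ : ∀ {x} i j → x ≤ i ⊎ x ≤ j → x ≤ i ⊔ j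
  ≤-⊔ i j (inj₁ x≤i) = i≤j⇒i≤j⊔k j x≤i
  ≤-⊔ i j (inj₂ x≤j) = i≤j⇒i≤k⊔j i x≤j
  ≤-head-or-tail : ∀ {x} → x ∈ s ∷ ss → x ≤ s ⊎ Any.Any (x ≤_) ss
  ≤-head-or-tail (here refl)  = inj₁ ≤-refl
  ≤-head-or-tail (there x∈ss) = inj₂ (Any.map ≤-reflexive x∈ss)

∈⇒min⁺≤ : ∀ {x} s ss → x ∈ s ∷ ss → min⁺ s ss ≤ x
∈⇒min⁺≤ s ss x∈ = foldr-preservesᵒ ⊓-≤ s ss (≥-head-or-tail x∈)
  where
  ⊓-≤ : ∀ {x} i j → i ≤ x ⊎ j ≤ x → i ⊓ j ≤ x
  ⊓-≤ i j (inj₁ i≤x) = i≤j⇒i⊓k≤j j i≤x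
  ⊓-≤ i j (inj₂ j≤x) = i≤j⇒k⊓i≤j i j≤x
  ≥-head-or-tail : ∀ {x} → x ∈ s ∷ ss → s ≤ x ⊎ Any.Any (_≤ x) ss
  ≥-head-or-tail (here refl)  = inj₁ ≤-refl
  ≥-head-or-tail (there x∈ss) = inj₂ (Any.map (λ x≡y → ≤-reflexive (sym x≡y)) x∈ss)

max⁺∈ : ∀ s ss → max⁺ s ss ∈ s ∷ ss
max⁺∈ s ss with foldr-selective ⊔-sel s ss
... | inj₁ max≡s  = here max≡s
... | inj₂ max∈ss = there max∈ss

min⁺∈ : ∀ s ss → min⁺ s ss ∈ s ∷ ss
min⁺∈ s ss with foldr-selective ⊓-sel s ss
... | inj₁ min≡s  = here min≡s
... | inj₂ min∈ss = there min∈ss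

-- The ms and dms orders refine the max and min orders respectively.
key : MType → List⁺ ℤ → ℤ
key max = val⁺ max
key min = val⁺ min
key ms  = val⁺ max
key dms = val⁺ min

strict⇒weak : ∀ μ {S T} → Strict μ S T → Weak μ S T
strict⇒weak max {_ ∷ _} {[]}    _   = tt
strict⇒weak max {_ ∷ _} {_ ∷ _} T<S = <⇒≤ T<S
strict⇒weak min {[]}    {_ ∷ _} _   = tt
strict⇒weak min {_ ∷ _} {_ ∷ _} T<S = <⇒≤ T<S
strict⇒weak ms  S≻T = inj₁ S≻T
strict⇒weak dms S≻T = inj₁ S≻T

≻max⇒≻ms : ∀ {S T} → S ≻max T → S ≻ms T
≻max⇒≻ms {[]} ()
≻max⇒≻ms {S@(_ ∷ _)} {T} S≻T =
  S , T , [] , ↭-reflexive (sym (++-identityʳ S)) , ↭-reflexive (sym (++-identityʳ T)) , tt , S≻T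

≻min⇒≻dms : ∀ {S T} → S ≻min T → S ≻dms T
≻min⇒≻dms {[]}    {[]} ()
≻min⇒≻dms {_ ∷ _} {[]} ()
≻min⇒≻dms {S} {T@(_ ∷ _)} S≻T =
  S , T , [] , ↭-reflexive (sym (++-identityʳ S)) , ↭-reflexive (sym (++-identityʳ T)) , tt , S≻T

key<⇒strict : ∀ μ S T → key μ T < key μ S → Strict μ (toList S) (toList T)
key<⇒strict max (_ ∷ _) (_ ∷ _) T<S = T<S
key<⇒strict min (_ ∷ _) (_ ∷ _) T<S = T<S
key<⇒strict ms  (_ ∷ _) (_ ∷ _) T<S = ≻max⇒≻ms T<S
key<⇒strict dms (_ ∷ _) (_ ∷ _) T<S = ≻min⇒≻dms T<S

≻max-dominates : ∀ {U V x} → U ≻max V → x ∈ V → ∃[ u ] (u ∈ U × x < u)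
≻max-dominates {[]}    ()
≻max-dominates {_ ∷ _} {[]} _ ()
≻max-dominates {u ∷ us} {v ∷ vs} V<U x∈V = max⁺ u us , max⁺∈ u us , ≤-<-trans (∈⇒≤max⁺ v vs x∈V) V<U

≻min-dominates : ∀ {U V x} → U ≻min V → x ∈ U → ∃[ v ] (v ∈ V × v < x)
≻min-dominates {[]}    _ ()
≻min-dominates {_ ∷ _} {[]} ()
≻min-dominates {u ∷ us} {v ∷ vs} V<U x∈U = min⁺ v vs , min⁺∈ v vs , <-≤-trans V<U (∈⇒min⁺≤ u us x∈U)

≻ms⇒max⁺≤ : ∀ s ss t ts → (s ∷ ss) ≻ms (t ∷ ts) → max⁺ t ts ≤ max⁺ s ss
≻ms⇒max⁺≤ s ss t ts (U , V , R , S↭U++R , T↭V++R , _ , U≻V) =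
  bound (∈-++⁻ V (∈-resp-↭ T↭V++R (max⁺∈ t ts)))
  where
  ≤max⁺S : ∀ {x} → x ∈ U ++ R → x ≤ max⁺ s ss
  ≤max⁺S x∈ = ∈⇒≤max⁺ s ss (∈-resp-↭ (↭-sym S↭U++R) x∈)
  bound : ∀ {m} → m ∈ V ⊎ m ∈ R → m ≤ max⁺ s ss
  bound (inj₂ m∈R) = ≤max⁺S (∈-++⁺ʳ U m∈R)
  bound (inj₁ m∈V) with ≻max-dominates U≻V m∈V
  ... | u , u∈U , m<u = ≤-trans (<⇒≤ m<u) (≤max⁺S (∈-++⁺ˡ u∈U))

≻dms⇒min⁺≤ : ∀ s ss t ts → (s ∷ ss) ≻dms (t ∷ ts) → min⁺ t ts ≤ min⁺ s ss
≻dms⇒min⁺≤ s ss t ts (U , V , R , S↭U++R , T↭V++R , _ , U≻V) =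
  bound (∈-++⁻ U (∈-resp-↭ S↭U++R (min⁺∈ s ss)))
  where
  min⁺T≤ : ∀ {x} → x ∈ V ++ R → min⁺ t ts ≤ x
  min⁺T≤ x∈ = ∈⇒min⁺≤ t ts (∈-resp-↭ (↭-sym T↭V++R) x∈)
  bound : ∀ {m} → m ∈ U ⊎ m ∈ R → min⁺ t ts ≤ m
  bound (inj₂ m∈R) = min⁺T≤ (∈-++⁺ʳ V m∈R)
  bound (inj₁ m∈U) with ≻min-dominates U≻V m∈U
  ... | v , v∈V , v<m = ≤-trans (min⁺T≤ (∈-++⁺ˡ v∈V)) (<⇒≤ v<m)

weak⇒key≤ : ∀ μ S T → Weak μ (toList S) (toList T) → key μ T ≤ key μ S
weak⇒key≤ max (_ ∷ _)  (_ ∷ _)  T≤S          = T≤S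
weak⇒key≤ min (_ ∷ _)  (_ ∷ _)  T≤S          = T≤S
weak⇒key≤ ms  (s ∷ ss) (t ∷ ts) (inj₁ S≻T)   = ≻ms⇒max⁺≤ s ss t ts S≻T
weak⇒key≤ ms  (s ∷ ss) (t ∷ ts) (inj₂ S↭T)   = ∈⇒≤max⁺ s ss (∈-resp-↭ (↭-sym S↭T) (max⁺∈ t ts))
weak⇒key≤ dms (s ∷ ss) (t ∷ ts) (inj₁ S≻T)   = ≻dms⇒min⁺≤ s ss t ts S≻T
weak⇒key≤ dms (s ∷ ss) (t ∷ ts) (inj₂ S↭T)   = ∈⇒min⁺≤ t ts (∈-resp-↭ S↭T (min⁺∈ s ss))

map-↭-++ : ∀ (f : ℤ → ℤ) {S} U R → S ↭ U ++ R → map f S ↭ map f U ++ map f R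
map-↭-++ f U R S↭U++R = ↭-trans (map⁺ f S↭U++R) (↭-reflexive (map-++ f U R))

map-nonEmpty : ∀ (f : ℤ → ℤ) {U} → NonEmpty U → NonEmpty (map f U)
map-nonEmpty f {_ ∷ _} _ = tt

module Monotone {f : ℤ → ℤ} (f-mono-< : Monotonic₁ _<_ _<_ f) where

  f-mono-≤ : Monotonic₁ _≤_ _≤_ f
  f-mono-≤ i≤j with ≤⇒<⊎≡ i≤j
  ... | inj₁ i<j  = <⇒≤ (f-mono-< i<j)
  ... | inj₂ refl = ≤-refl

  map-max⁺ : ∀ s ss → max⁺ (f s) (map f ss) ≡ f (max⁺ s ss)
  map-max⁺ s []       = refl
  map-max⁺ s (x ∷ xs) = trans (cong (f x ⊔_) (map-max⁺ s xs)) (sym (mono-<-distrib-⊔ f f-mono-< x _))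

  map-min⁺ : ∀ s ss → min⁺ (f s) (map f ss) ≡ f (min⁺ s ss)
  map-min⁺ s []       = refl
  map-min⁺ s (x ∷ xs) = trans (cong (f x ⊓_) (map-min⁺ s xs)) (sym (mono-<-distrib-⊓ f f-mono-< x _))

  key-map : ∀ μ S → key μ (List⁺.map f S) ≡ f (key μ S)
  key-map max (s ∷ ss) = map-max⁺ s ss
  key-map min (s ∷ ss) = map-min⁺ s ss
  key-map ms  (s ∷ ss) = map-max⁺ s ss
  key-map dms (s ∷ ss) = map-min⁺ s ss

  map-≻max : ∀ {U V} → U ≻max V → map f U ≻max map f V
  map-≻max {_ ∷ _}  {[]}     _   = tt
  map-≻max {u ∷ us} {v ∷ vs} V<U = subst₂ _<_ (sym (map-max⁺ v vs)) (sym (map-max⁺ u us)) (f-mono-< V<U)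

  map-≻min : ∀ {U V} → U ≻min V → map f U ≻min map f V
  map-≻min {[]}     {_ ∷ _}  _   = tt
  map-≻min {u ∷ us} {v ∷ vs} V<U = subst₂ _<_ (sym (map-min⁺ v vs)) (sym (map-min⁺ u us)) (f-mono-< V<U)

  map-≻ms : ∀ {S T} → S ≻ms T → map f S ≻ms map f T
  map-≻ms (U , V , R , S↭ , T↭ , U≢[] , U≻V) =
    map f U , map f V , map f R , map-↭-++ f U R S↭ , map-↭-++ f V R T↭ , map-nonEmpty f U≢[] , map-≻max U≻V

  map-≻dms : ∀ {S T} → S ≻dms T → map f S ≻dms map f T
  map-≻dms (U , V , R , S↭ , T↭ , V≢[] , U≻V) =
    map f U , map f V , map f R , map-↭-++ f U R S↭ , map-↭-++ f V R T↭ , map-nonEmpty f V≢[] , map-≻min U≻V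

  map-strict : ∀ μ {S T} → Strict μ S T → Strict μ (map f S) (map f T)
  map-strict max = map-≻max
  map-strict min = map-≻min
  map-strict ms  = map-≻ms
  map-strict dms = map-≻dms

  map-weak : ∀ μ {S T} → Weak μ S T → Weak μ (map f S) (map f T)
  map-weak max {_}      {[]}     _   = tt
  map-weak max {s ∷ ss} {t ∷ ts} T≤S = subst₂ _≤_ (sym (map-max⁺ t ts)) (sym (map-max⁺ s ss)) (f-mono-≤ T≤S)
  map-weak min {[]}     {_}      _   = tt
  map-weak min {s ∷ ss} {t ∷ ts} T≤S = subst₂ _≤_ (sym (map-min⁺ t ts)) (sym (map-min⁺ s ss)) (f-mono-≤ T≤S)
  map-weak ms  (inj₁ S≻T) = inj₁ (map-≻ms S≻T)
  map-weak ms  (inj₂ S↭T) = inj₂ (map⁺ f S↭T)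
  map-weak dms (inj₁ S≻T) = inj₁ (map-≻dms S≻T)
  map-weak dms (inj₂ S↭T) = inj₂ (map⁺ f S↭T)

dual : MType → MType
dual max = min
dual min = max
dual ms  = dms
dual dms = ms

module Antitone {f : ℤ → ℤ} (f-anti-< : Monotonic₁ _<_ _>_ f) where

  f-anti-≤ : Monotonic₁ _≤_ _≥_ f
  f-anti-≤ i≤j with ≤⇒<⊎≡ i≤j
  ... | inj₁ i<j  = <⇒≤ (f-anti-< i<j)
  ... | inj₂ refl = ≤-refl

  map-max⁺ : ∀ s ss → min⁺ (f s) (map f ss) ≡ f (max⁺ s ss)
  map-max⁺ s []       = refl
  map-max⁺ s (x ∷ xs) = trans (cong (f x ⊓_) (map-max⁺ s xs)) (sym (antimono-<-distrib-⊔ f f-anti-< x _))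

  map-min⁺ : ∀ s ss → max⁺ (f s) (map f ss) ≡ f (min⁺ s ss)
  map-min⁺ s []       = refl
  map-min⁺ s (x ∷ xs) = trans (cong (f x ⊔_) (map-min⁺ s xs)) (sym (antimono-<-distrib-⊓ f f-anti-< x _))

  key-map : ∀ μ S → key (dual μ) (List⁺.map f S) ≡ f (key μ S)
  key-map max (s ∷ ss) = map-max⁺ s ss
  key-map min (s ∷ ss) = map-min⁺ s ss
  key-map ms  (s ∷ ss) = map-max⁺ s ss
  key-map dms (s ∷ ss) = map-min⁺ s ss

  map-≻max : ∀ {U V} → U ≻max V → map f V ≻min map f U
  map-≻max {_ ∷ _}  {[]}     _   = tt
  map-≻max {u ∷ us} {v ∷ vs} V<U = subst₂ _<_ (sym (map-max⁺ u us)) (sym (map-max⁺ v vs)) (f-anti-< V<U)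

  map-≻min : ∀ {U V} → U ≻min V → map f V ≻max map f U
  map-≻min {[]}     {_ ∷ _}  _   = tt
  map-≻min {u ∷ us} {v ∷ vs} V<U = subst₂ _<_ (sym (map-min⁺ u us)) (sym (map-min⁺ v vs)) (f-anti-< V<U)

  map-≻ms : ∀ {S T} → S ≻ms T → map f T ≻dms map f S
  map-≻ms (U , V , R , S↭ , T↭ , U≢[] , U≻V) =
    map f V , map f U , map f R , map-↭-++ f V R T↭ , map-↭-++ f U R S↭ , map-nonEmpty f U≢[] , map-≻max U≻V

  map-≻dms : ∀ {S T} → S ≻dms T → map f T ≻ms map f S
  map-≻dms (U , V , R , S↭ , T↭ , V≢[] , U≻V) =
    map f V , map f U , map f R , map-↭-++ f V R T↭ , map-↭-++ f U R S↭ , map-nonEmpty f V≢[] , map-≻min U≻V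

  map-strict : ∀ μ {S T} → Strict μ S T → Strict (dual μ) (map f T) (map f S)
  map-strict max = map-≻max
  map-strict min = map-≻min
  map-strict ms  = map-≻ms
  map-strict dms = map-≻dms

  map-weak : ∀ μ {S T} → Weak μ S T → Weak (dual μ) (map f T) (map f S)
  map-weak max {_}      {[]}     _   = tt
  map-weak max {s ∷ ss} {t ∷ ts} T≤S = subst₂ _≤_ (sym (map-max⁺ s ss)) (sym (map-max⁺ t ts)) (f-anti-≤ T≤S)
  map-weak min {[]}     {_}      _   = tt
  map-weak min {s ∷ ss} {t ∷ ts} T≤S = subst₂ _≤_ (sym (map-min⁺ s ss)) (sym (map-min⁺ t ts)) (f-anti-≤ T≤S)
  map-weak ms  (inj₁ S≻T) = inj₁ (map-≻ms S≻T)
  map-weak ms  (inj₂ S↭T) = inj₂ (map⁺ f (↭-sym S↭T))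
  map-weak dms (inj₁ S≻T) = inj₁ (map-≻dms S≻T)
  map-weak dms (inj₂ S↭T) = inj₂ (map⁺ f (↭-sym S↭T))

_⊖_ : List ℤ → ℤ → List ℤ
S ⊖ c = map (λ x → x - c) S

_⊝_ : ℤ → List ℤ → List ℤ
v ⊝ S = map (λ x → v - x) S

module Shift (c : ℤ) = Monotone {λ x → x - c} (+-monoˡ-< (- c))
module Reflect (v : ℤ) = Antitone {λ x → v - x} (λ i<j → +-monoʳ-< v (neg-mono-< i<j))

⊖-mono-≿-< : ∀ μ H H′ {c c′} → Weak μ (toList H) (toList H′) → c < c′ →
             Strict μ (toList H ⊖ c) (toList H′ ⊖ c′)
⊖-mono-≿-< μ H@(_ ∷ _) H′@(_ ∷ _) {c} {c′} H≿H′ c<c′ =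
  key<⇒strict μ (List⁺.map (λ x → x - c) H) (List⁺.map (λ x → x - c′) H′)
    (subst₂ _<_ (sym (Shift.key-map c′ μ H′)) (sym (Shift.key-map c μ H))
      (+-mono-≤-< (weak⇒key≤ μ H H′ H≿H′) (neg-mono-< c<c′)))

⊖-mono-≻-≤ : ∀ μ H H′ {c c′} → Strict μ (toList H) (toList H′) → c ≤ c′ →
             Strict μ (toList H ⊖ c) (toList H′ ⊖ c′)
⊖-mono-≻-≤ μ H H′ {c} H≻H′ c≤c′ with ≤⇒<⊎≡ c≤c′
... | inj₁ c<c′ = ⊖-mono-≿-< μ H H′ (strict⇒weak μ H≻H′) c<c′
... | inj₂ refl = Shift.map-strict c μ H≻H′

⊖-mono-≿-≤ : ∀ μ H H′ {c c′} → Weak μ (toList H) (toList H′) → c ≤ c′ →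
             Weak μ (toList H ⊖ c) (toList H′ ⊖ c′)
⊖-mono-≿-≤ μ H H′ {c} H≿H′ c≤c′ with ≤⇒<⊎≡ c≤c′
... | inj₁ c<c′ = strict⇒weak μ (⊖-mono-≿-< μ H H′ H≿H′ c<c′)
... | inj₂ refl = Shift.map-weak c μ H≿H′

⊝-mono-<-≿ : ∀ μ L L′ {v v′} → v′ < v → Weak μ (toList L′) (toList L) →
             Strict (dual μ) (v ⊝ toList L) (v′ ⊝ toList L′)
⊝-mono-<-≿ μ L@(_ ∷ _) L′@(_ ∷ _) {v} {v′} v′<v L′≿L =
  key<⇒strict (dual μ) (List⁺.map (λ x → v - x) L) (List⁺.map (λ x → v′ - x) L′)
    (subst₂ _<_ (sym (Reflect.key-map v′ μ L′)) (sym (Reflect.key-map v μ L))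
      (+-mono-<-≤ v′<v (neg-mono-≤ (weak⇒key≤ μ L′ L L′≿L))))

⊝-mono-≤-≻ : ∀ μ L L′ {v v′} → v′ ≤ v → Strict μ (toList L′) (toList L) →
             Strict (dual μ) (v ⊝ toList L) (v′ ⊝ toList L′)
⊝-mono-≤-≻ μ L L′ {v} v′≤v L′≻L with ≤⇒<⊎≡ v′≤v
... | inj₁ v′<v = ⊝-mono-<-≿ μ L L′ v′<v (strict⇒weak μ L′≻L)
... | inj₂ refl = Reflect.map-strict v μ L′≻L

⊝-mono-≤-≿ : ∀ μ L L′ {v v′} → v′ ≤ v → Weak μ (toList L′) (toList L) →
             Weak (dual μ) (v ⊝ toList L) (v′ ⊝ toList L′)
⊝-mono-≤-≿ μ L L′ {v} v′≤v L′≿L with ≤⇒<⊎≡ v′≤v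
... | inj₁ v′<v = strict⇒weak (dual μ) (⊝-mono-<-≿ μ L L′ v′<v L′≿L)
... | inj₂ refl = Reflect.map-weak v μ L′≿L

lemma3 : (μL μH : MType) → Compatible μL μH →
    (L H L′ H′ : List⁺ ℤ) →
    ((Weak μH (toList H) (toList H′) → Weak μL (toList L′) (toList L) →
        Weak (diffType μL μH) (diff μL μH H L) (diff μL μH H′ L′))
    × (Strict μH (toList H) (toList H′) → Weak μL (toList L′) (toList L) →
        Strict (diffType μL μH) (diff μL μH H L) (diff μL μH H′ L′))
    × (Weak μH (toList H) (toList H′) → Strict μL (toList L′) (toList L) →
        Strict (diffType μL μH) (diff μL μH H L) (diff μL μH H′ L′)))
lemma3 max μH _ (_ ∷ _) H (_ ∷ _) H′ = ⊖-mono-≿-≤ μH H H′ , ⊖-mono-≻-≤ μH H H′ , ⊖-mono-≿-< μH H H′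
lemma3 min μH _ (_ ∷ _) H (_ ∷ _) H′ = ⊖-mono-≿-≤ μH H H′ , ⊖-mono-≻-≤ μH H H′ , ⊖-mono-≿-< μH H H′
lemma3 ms  max _ L (_ ∷ _) L′ (_ ∷ _) = ⊝-mono-≤-≿ ms L L′ , ⊝-mono-<-≿ ms L L′ , ⊝-mono-≤-≻ ms L L′
lemma3 ms  min _ L (_ ∷ _) L′ (_ ∷ _) = ⊝-mono-≤-≿ ms L L′ , ⊝-mono-<-≿ ms L L′ , ⊝-mono-≤-≻ ms L L′
lemma3 dms max _ L (_ ∷ _) L′ (_ ∷ _) = ⊝-mono-≤-≿ dms L L′ , ⊝-mono-<-≿ dms L L′ , ⊝-mono-≤-≻ dms L L′
lemma3 dms min _ L (_ ∷ _) L′ (_ ∷ _) = ⊝-mono-≤-≿ dms L L′ , ⊝-mono-<-≿ dms L L′ , ⊝-mono-≤-≻ dms L L′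
lemma3 ms  ms  (inj₁ ()) _ _ _ _
lemma3 ms  ms  (inj₂ ()) _ _ _ _
lemma3 ms  dms (inj₁ ()) _ _ _ _
lemma3 ms  dms (inj₂ ()) _ _ _ _
lemma3 dms ms  (inj₁ ()) _ _ _ _
lemma3 dms ms  (inj₂ ()) _ _ _ _
lemma3 dms dms (inj₁ ()) _ _ _ _
lemma3 dms dms (inj₂ ()) _ _ _ _
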